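{- Let $m\ge1$ and $W=W^{(m)}_4$. Then $$\sum_{\gamma\in D_1\cup D_2}q^{\mathrm{area}(\gamma)}t^{\mathrm{dinv}_m(\gamma)}=\sum_{\gamma\in D'_1\cup D'_2}t^{\mathrm{area}(\gamma)}q^{\mathrm{dinv}_m(\gamma)}\quad\text{and}\quad\sum_{\gamma\in D_3}q^{\mathrm{area}(\gamma)}t^{\mathrm{dinv}_m(\gamma)}=\sum_{\gamma\in D'_3}t^{\mathrm{area}(\gamma)}q^{\mathrm{dinv}_m(\gamma)}.$$
   Context: $W^{(m)}_4$ is the set of sequences $\gamma=(\gamma_0,\gamma_1,\gamma_2,\gamma_3)$ of nonnegative integers with $\gamma_0=0$ and $\gamma_i\le\gamma_{i-1}+m$ for $i=1,2,3$. $\mathrm{area}(\gamma)=\sum_i\gamma_i$ and $\mathrm{dinv}_m(\gamma)=\sum_{0\le i<j\le3}\mathrm{sc}_m(\gamma_i-\gamma_j)$, where $\mathrm{sc}_m(p)=m+1-p$ if $1\le p\le m$, $\mathrm{sc}_m(p)=m+p$ if $-m\le p\le0$, and $0$ otherwise. The sets are: $D_1=\{(0,\gamma_1,\gamma_2,\gamma_2+m):0<\gamma_1\le m<\gamma_2\le\gamma_1+m\}$, $D_2=\{(0,\gamma_1,m,\gamma_3):0\le\gamma_1\le m,\ \gamma_1+m\le\gamma_3\le2m\}$, $D_3=\{(0,0,\gamma_2,\gamma_3):0\le\gamma_2<m\le\gamma_3\le\gamma_2+m\}$, $D'_1=\{\gamma\in W:\gamma_1=0,\ \gamma_2>\gamma_3\}$,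 $D'_2=\{\gamma\in W:\gamma_1=0,\ \gamma_2\le\gamma_3\le m\}$, $D'_3=\{\gamma\in W:\gamma_1=0,\ \gamma_3>m\}$. -}

module Defs where

open import Data.Bool using (Bool; true; false; _∧_; _∨_; if_then_else_)
open import Data.Nat as ℕ using (ℕ; _≤ᵇ_; _<ᵇ_; _≡ᵇ_)
open import Data.Integer as ℤ using (ℤ; +_; -_)
open import Data.Integer.Properties using () renaming (_≤?_ to _≤ℤ?_; _≟_ to _≟ℤ_)
open import Data.Product using (_×_; _,_)
open import Data.List using (List; filterᵇ; length; upTo; concatMap; map)
open import Relation.Nullary.Decidable using (⌊_⌋)

Seq : Set
Seq = ℕ × ℕ × ℕ × ℕ

infix 4 _≤z_
_≤z_ : ℤ → ℤ → Bool
a ≤z b = ⌊ a ≤ℤ? b ⌋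

inW : ℕ → Seq → Bool
inW m (g0 , g1 , g2 , g3) =
  (g0 ≡ᵇ 0) ∧ (g1 ≤ᵇ g0 ℕ.+ m) ∧ (g2 ≤ᵇ g1 ℕ.+ m) ∧ (g3 ≤ᵇ g2 ℕ.+ m)

box : ℕ → List Seq
box N = concatMap (λ a → concatMap (λ b → concatMap (λ c →
          map (λ d → (a , b , c , d)) (upTo (ℕ.suc N)))
          (upTo (ℕ.suc N))) (upTo (ℕ.suc N))) (upTo (ℕ.suc N))

-- W^{(m)}_4 as a finite list (every element of W has entries ≤ 3m)
W : ℕ → List Seq
W m = filterᵇ (inW m) (box (3 ℕ.* m))

area : Seq → ℕ
area (g0 , g1 , g2 , g3) = g0 ℕ.+ g1 ℕ.+ g2 ℕ.+ g3

sc : ℕ → ℤ → ℤ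
sc m p =
  if (+ 1 ≤z p) ∧ (p ≤z + m) then (+ m ℤ.+ + 1) ℤ.- p
  else if (- (+ m) ≤z p) ∧ (p ≤z + 0) then + m ℤ.+ p
  else + 0

dinv : ℕ → Seq → ℤ
dinv m (g0 , g1 , g2 , g3) =
  s g0 g1 ℤ.+ s g0 g2 ℤ.+ s g0 g3 ℤ.+ s g1 g2 ℤ.+ s g1 g3 ℤ.+ s g2 g3
  where
  s : ℕ → ℕ → ℤ
  s a b = sc m (+ a ℤ.- + b)

inD1 : ℕ → Seq → Bool
inD1 m (g0 , g1 , g2 , g3) =
  (g0 ≡ᵇ 0) ∧ (0 <ᵇ g1) ∧ (g1 ≤ᵇ m) ∧ (m <ᵇ g2) ∧ (g2 ≤ᵇ g1 ℕ.+ m) ∧ (g3 ≡ᵇ g2 ℕ.+ m)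

inD2 : ℕ → Seq → Bool
inD2 m (g0 , g1 , g2 , g3) =
  (g0 ≡ᵇ 0) ∧ (g1 ≤ᵇ m) ∧ (g2 ≡ᵇ m) ∧ (g1 ℕ.+ m ≤ᵇ g3) ∧ (g3 ≤ᵇ 2 ℕ.* m)

inD3 : ℕ → Seq → Bool
inD3 m (g0 , g1 , g2 , g3) =
  (g0 ≡ᵇ 0) ∧ (g1 ≡ᵇ 0) ∧ (g2 <ᵇ m) ∧ (m ≤ᵇ g3) ∧ (g3 ≤ᵇ g2 ℕ.+ m)

-- The sets D'₁, D'₂, D'₃ (intersected with W below)
inD1' : ℕ → Seq → Bool
inD1' m (g0 , g1 , g2 , g3) = (g1 ≡ᵇ 0) ∧ (g3 <ᵇ g2)

inD2' : ℕ → Seq → Bool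
inD2' m (g0 , g1 , g2 , g3) = (g1 ≡ᵇ 0) ∧ (g2 ≤ᵇ g3) ∧ (g3 ≤ᵇ m)

inD3' : ℕ → Seq → Bool
inD3' m (g0 , g1 , g2 , g3) = (g1 ≡ᵇ 0) ∧ (m <ᵇ g3)

sub : ℕ → (Seq → Bool) → List Seq
sub m P = filterᵇ P (W m)

-- Coefficient of q^a t^d in  Σ_{γ∈S} q^{area γ} t^{dinv γ}
coeffQT : ℕ → List Seq → ℤ → ℤ → ℕ
coeffQT m S a d = length (filterᵇ (λ γ → ⌊ + area γ ≟ℤ a ⌋ ∧ ⌊ dinv m γ ≟ℤ d ⌋) S)

-- Coefficient of q^a t^d in  Σ_{γ∈S} t^{area γ} q^{dinv γ}
coeffTQ : ℕ → List Seq → ℤ → ℤ → ℕ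
coeffTQ m S a d = length (filterᵇ (λ γ → ⌊ dinv m γ ≟ℤ a ⌋ ∧ ⌊ + area γ ≟ℤ d ⌋) S)

module Submission where

-- Both identities come from bijections that exchange area and dinv.
--
-- Second identity: on D₃ and on D'₃ (both inside the band c ≤ m ≤ e ≤ c + m) one has
-- dinv (0,0,c,e) = 4m − c − e, and the reflection (c , e) ↦ (2m − e , 2m − c) maps D'₃ onto D₃.
--
-- First identity: inside W, D'₁ ∪ D'₂ is the square of all (0,0,c,d) with c , d ≤ m, on which
-- dinv = 6m + 1 − s − k for the code s = c + d, k = 2c if d < c and k = 2d + 1 otherwise; the
-- parity of k tells which case occurred, so the code determines (c , d). On D₁ ∪ D₂ one has
-- dinv = 3m − γ₃, and the element with dinv s and area 6m + 1 − s − k is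
-- (0 , s + m + 1 − k , 2m − s , 3m − s) ∈ D₁ when s < m and (0 , 2m + 1 − k , m , 3m − s) ∈ D₂ when s ≥ m.
--
-- A coefficient is the length of a filter of the duplicate-free list W, so a bijection between
-- the two sets exchanging area and dinv makes the coefficients agree.

open import Defs
open import Algebra.Bundles using (AbelianGroup)
open import Data.Bool using (Bool; true; false; T; _∧_; _∨_)
open import Data.Bool.Properties using (T?; T-∧; T-∨)
open import Data.Empty using (⊥)
open import Data.Fin using (Fin; zero; suc)
open import Data.Fin.Properties using (injective⇒≤)
open import Data.Integer as ℤ using (ℤ; +_)
import Data.Integer.Properties as ZP
open import Data.Integer.Properties using () renaming (_≟_ to _≟ℤ_; _≤?_ to _≤ℤ?_)
import Data.Integer.Tactic.RingSolver as ℤSolver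
import Data.List as L
open import Data.List using (List; length; lookup; concatMap; map; filterᵇ; upTo)
open import Data.List.Membership.Propositional using (_∈_; lose)
open import Data.List.Membership.Propositional.Properties
  using (∈-lookup; ∈-filter⁺; ∈-filter⁻; ∈-concatMap⁺; ∈-map⁺; ∈-upTo⁺)
import Data.List.Membership.Setoid.Properties as SetoidMembership
open import Data.List.Relation.Unary.All as All using (All)
import Data.List.Relation.Unary.All.Properties as All
open import Data.List.Relation.Unary.AllPairs as AllPairs using (_∷_)
import Data.List.Relation.Unary.AllPairs.Properties as AllPairs
open import Data.List.Relation.Unary.Any using (index)
open import Data.List.Relation.Unary.Unique.Propositional using (Unique)
import Data.List.Relation.Unary.Unique.Propositional.Properties as Unique
open import Data.Nat as ℕ using (ℕ; zero; suc; _≥_; _+_; _∸_; _*_; _≤_; _<_; s≤s; z≤n; _<?_)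
open import Data.Nat.Properties
  using ( ≤ᵇ⇒≤; ≡ᵇ⇒≡; ≤⇒≤ᵇ; <ᵇ⇒<; <⇒<ᵇ; ≡⇒≡ᵇ; suc-injective
        ; ≤-refl; ≤-reflexive; ≤-trans; ≤-antisym; ≤-<-trans
        ; <⇒≤; <⇒≱; ≰⇒>; ≮⇒≥; m≤n⇒m<n∨m≡n
        ; m≤m+n; m≤n+m; m≤n⇒m≤1+n; +-comm; +-assoc; +-suc; +-identityʳ
        ; +-mono-≤; +-monoˡ-≤; +-monoʳ-≤; +-monoʳ-<; +-cancelˡ-≡; +-cancelʳ-≡; +-cancelʳ-≤
        ; m+n∸m≡n; m+n∸n≡m; m∸n+n≡m; m+[n∸m]≡n; m∸[m∸n]≡n; m∸n≤m; +-∸-comm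
        ; m<n⇒0<n∸m; m≤n+o⇒m∸n≤o; m+n≤o⇒m≤o∸n; ∸-monoʳ-<; ∸-cancelˡ-≡
        ; +-commutativeSemigroup; module ≤-Reasoning )
open import Data.Nat.Tactic.RingSolver using (solve)
open import Data.Product using (∃; _×_; _,_; proj₁; proj₂)
open import Data.Sum using (_⊎_; inj₁; inj₂)
open import Function using (_∘_; _⇔_; mk⇔; Equivalence)
open import Relation.Binary.PropositionalEquality
open import Relation.Nullary using (¬_; Dec; yes; no; contradiction)
open import Relation.Nullary.Decidable using (⌊_⌋; toWitness; fromWitness; dec-true; dec-false; isYes≗does)

open import Algebra.Properties.CommutativeSemigroup +-commutativeSemigroup using (x∙yz≈y∙xz)
open import Algebra.Properties.Group (AbelianGroup.group ZP.+-0-abelianGroup) using (∙-cancelʳ)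

private
  variable
    A B : Set

lookup-injective : {xs : List A} → Unique xs → ∀ i j → lookup xs i ≡ lookup xs j → i ≡ j
lookup-injective (_ ∷ _) zero zero _ = refl
lookup-injective (x∉xs ∷ _) zero (suc j) eq = contradiction eq (All.lookup x∉xs (∈-lookup j))
lookup-injective (x∉xs ∷ _) (suc i) zero eq = contradiction (sym eq) (All.lookup x∉xs (∈-lookup i))
lookup-injective (_ ∷ xs!) (suc i) (suc j) eq = cong suc (lookup-injective xs! i j eq)

-- f may depend on the membership proof, so that preimages chosen under a surjection qualify.
length-≤-of-injection : {xs : List A} {ys : List B} → Unique xs →
  (f : ∀ {x} → x ∈ xs → B) → (∀ {x} (p : x ∈ xs) → f p ∈ ys) →
  (∀ {x y} (p : x ∈ xs) (q : y ∈ xs) → f p ≡ f q → x ≡ y) →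
  length xs ≤ length ys
length-≤-of-injection {xs = xs} xs! f f∈ f-injective = injective⇒≤ h-injective
  where
  h : Fin (length xs) → Fin _
  h i = index (f∈ (∈-lookup i))
  h-injective : ∀ {i j} → h i ≡ h j → i ≡ j
  h-injective {i} {j} eq = lookup-injective xs! i j
    (f-injective (∈-lookup i) (∈-lookup j)
      (SetoidMembership.index-injective (setoid _) (f∈ (∈-lookup i)) (f∈ (∈-lookup j)) eq))

length-≡-of-bijection : {xs : List A} {ys : List B} → Unique xs → Unique ys →
  (f : A → B) → (∀ {x} → x ∈ xs → f x ∈ ys) →
  (∀ {x y} → x ∈ xs → y ∈ xs → f x ≡ f y → x ≡ y) →
  (∀ {y} → y ∈ ys → ∃ λ x → x ∈ xs × f x ≡ y) →
  length xs ≡ length ys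
length-≡-of-bijection {ys = ys} xs! ys! f f∈ f-injective f-surjective = ≤-antisym
  (length-≤-of-injection xs! (λ {x} _ → f x) f∈ f-injective)
  (length-≤-of-injection ys! (proj₁ ∘ f-surjective) (proj₁ ∘ proj₂ ∘ f-surjective)
    (λ p q eq → trans (sym (section p)) (trans (cong f eq) (section q))))
  where
  section : ∀ {y} (p : y ∈ ys) → f (proj₁ (f-surjective p)) ≡ y
  section p = proj₂ (proj₂ (f-surjective p))

All-concatMap⁺ : {P : A → Set} (f : B → List A) (xs : List B) →
  (∀ x → All P (f x)) → All P (concatMap f xs)
All-concatMap⁺ f xs Pf = All.concat⁺ (All.map⁺ {xs = xs} (All.universal Pf xs))

concatMap⁺ : (f : B → List A) {xs : List B} (key : A → B) →
  Unique xs → (∀ x → Unique (f x)) → (∀ x → All (λ y → key y ≡ x) (f x)) →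
  Unique (concatMap f xs)
concatMap⁺ f {xs} key xs! f! keyed = Unique.concat⁺ (All.map⁺ {xs = xs} (All.universal f! xs))
  (AllPairs.map⁺ {f = f} {xs = xs} (AllPairs.map disjoint xs!))
  where
  disjoint : ∀ {x x′} → x ≢ x′ → ∀ {y} → y ∈ f x × y ∈ f x′ → ⊥
  disjoint x≢x′ (p , q) = x≢x′ (trans (sym (All.lookup (keyed _) p)) (All.lookup (keyed _) q))

fibre₃ : ℕ → ℕ → ℕ → ℕ → List Seq
fibre₃ N a b c = map (λ d → (a , b , c , d)) (upTo (suc N))

fibre₂ : ℕ → ℕ → ℕ → List Seq
fibre₂ N a b = concatMap (fibre₃ N a b) (upTo (suc N))

fibre₁ : ℕ → ℕ → List Seq
fibre₁ N a = concatMap (fibre₂ N a) (upTo (suc N))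

box-unique : ∀ N → Unique (box N)
box-unique N =
  concatMap⁺ (fibre₁ N) proj₁ U! (λ a → concatMap⁺ (fibre₂ N a) (proj₁ ∘ proj₂) U! (λ b →
      concatMap⁺ (fibre₃ N a b) (proj₁ ∘ proj₂ ∘ proj₂) U!
        (λ c → Unique.map⁺ (cong (proj₂ ∘ proj₂ ∘ proj₂)) U!)
        (λ c → constant (λ _ → refl)))
      (λ b → All-concatMap⁺ (fibre₃ N a b) U (λ c → constant (λ _ → refl))))
    (λ a → All-concatMap⁺ (fibre₂ N a) U (λ b →
      All-concatMap⁺ (fibre₃ N a b) U (λ c → constant (λ _ → refl))))
  where
  U = upTo (suc N)
  U! = Unique.upTo⁺ (suc N)
  constant : {B : Set} {key : Seq → B} {g : ℕ → Seq} {x : B} → (∀ d → key (g d) ≡ x) →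
    All (λ y → key y ≡ x) (map g U)
  constant k = All.map⁺ (All.universal k U)

∈-box : ∀ {N a b c d} → a ≤ N → b ≤ N → c ≤ N → d ≤ N → (a , b , c , d) ∈ box N
∈-box {N} {a} {b} {c} {d} a≤N b≤N c≤N d≤N =
  ∈-concatMap⁺ (fibre₁ N) (lose (∈-upTo⁺ (s≤s a≤N))
    (∈-concatMap⁺ (fibre₂ N a) (lose (∈-upTo⁺ (s≤s b≤N))
      (∈-concatMap⁺ (fibre₃ N a b) (lose (∈-upTo⁺ (s≤s c≤N))
        (∈-map⁺ (λ d → (a , b , c , d)) (∈-upTo⁺ (s≤s d≤N))))))))

∧⁻ : ∀ x {y} → T (x ∧ y) → T x × T y
∧⁻ x = Equivalence.to (T-∧ {x})

∧⁺ : ∀ {x y} → T x → T y → T (x ∧ y)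
∧⁺ p q = Equivalence.from T-∧ (p , q)

⌊⌋-true : ∀ {P : Set} (P? : Dec P) → P → ⌊ P? ⌋ ≡ true
⌊⌋-true P? p = trans (isYes≗does P?) (dec-true P? p)

⌊⌋-false : ∀ {P : Set} (P? : Dec P) → ¬ P → ⌊ P? ⌋ ≡ false
⌊⌋-false P? ¬p = trans (isYes≗does P?) (dec-false P? ¬p)

inW⁻ : ∀ {m g₀ g₁ g₂ g₃} → T (inW m (g₀ , g₁ , g₂ , g₃)) →
  g₀ ≡ 0 × g₁ ≤ g₀ + m × g₂ ≤ g₁ + m × g₃ ≤ g₂ + m
inW⁻ {m} {g₀} {g₁} {g₂} {g₃} t =
  let (t₀ , t)  = ∧⁻ (g₀ ℕ.≡ᵇ 0) t
      (t₁ , t)  = ∧⁻ (g₁ ℕ.≤ᵇ g₀ + m) t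
      (t₂ , t₃) = ∧⁻ (g₂ ℕ.≤ᵇ g₁ + m) t
  in ≡ᵇ⇒≡ g₀ 0 t₀ , ≤ᵇ⇒≤ g₁ _ t₁ , ≤ᵇ⇒≤ g₂ _ t₂ , ≤ᵇ⇒≤ g₃ _ t₃

inW⁺ : ∀ {m b c e} → b ≤ m → c ≤ b + m → e ≤ c + m → T (inW m (0 , b , c , e))
inW⁺ b≤ c≤ e≤ = ∧⁺ {true} _ (∧⁺ (≤⇒≤ᵇ b≤) (∧⁺ (≤⇒≤ᵇ c≤) (≤⇒≤ᵇ e≤)))

inW⇒∈box : ∀ {m} γ → T (inW m γ) → γ ∈ box (3 * m)
inW⇒∈box {m} (g₀ , g₁ , g₂ , g₃) t with inW⁻ {m} {g₀} {g₁} {g₂} {g₃} t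
... | refl , g₁≤m , g₂≤g₁+m , g₃≤g₂+m =
  subst (λ N → (0 , g₁ , g₂ , g₃) ∈ box N) 3m≡3*m
    (∈-box z≤n (≤-trans g₁≤m m≤3m) (≤-trans g₂≤2m 2m≤3m) g₃≤3m)
  where
  g₂≤2m : g₂ ≤ m + m
  g₂≤2m = ≤-trans g₂≤g₁+m (+-monoˡ-≤ m g₁≤m)
  g₃≤3m : g₃ ≤ m + m + m
  g₃≤3m = ≤-trans g₃≤g₂+m (+-monoˡ-≤ m g₂≤2m)
  2m≤3m : m + m ≤ m + m + m
  2m≤3m = m≤m+n (m + m) m
  m≤3m : m ≤ m + m + m
  m≤3m = ≤-trans (m≤m+n m m) 2m≤3m
  3m≡3*m : m + m + m ≡ 3 * m
  3m≡3*m = solve (m L.∷ L.[])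

∈-sub : ∀ {m Q γ} → γ ∈ sub m Q ⇔ (T (inW m γ) × T (Q γ))
∈-sub {m} {Q} {γ} = mk⇔ to from
  where
  to : γ ∈ sub m Q → T (inW m γ) × T (Q γ)
  to p = let (p , Qγ) = ∈-filter⁻ (T? ∘ Q) p
         in proj₂ (∈-filter⁻ (T? ∘ inW m) {xs = box (3 * m)} p) , Qγ
  from : T (inW m γ) × T (Q γ) → γ ∈ sub m Q
  from (Wγ , Qγ) = ∈-filter⁺ (T? ∘ Q) (∈-filter⁺ (T? ∘ inW m) (inW⇒∈box γ Wγ) Wγ) Qγ

∈-sub-via : ∀ {m} Q {A : Seq → Set} →
  (∀ γ → T (inW m γ) × T (Q γ) → A γ) → (∀ {γ} → A γ → T (inW m γ) × T (Q γ)) →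
  ∀ {γ} → γ ∈ sub m Q ⇔ A γ
∈-sub-via Q to from =
  mk⇔ (to _ ∘ Equivalence.to (∈-sub {Q = Q})) (Equivalence.from (∈-sub {Q = Q}) ∘ from)

sub-unique : ∀ m Q → Unique (sub m Q)
sub-unique m Q = Unique.filter⁺ (T? ∘ Q) (Unique.filter⁺ (T? ∘ inW m) (box-unique (3 * m)))

-- Coefficients and bijections exchanging area and dinv

stat-filter : (Seq → ℤ) → (Seq → ℤ) → ℤ → ℤ → List Seq → List Seq
stat-filter u v a d = filterᵇ (λ γ → ⌊ u γ ≟ℤ a ⌋ ∧ ⌊ v γ ≟ℤ d ⌋)

∈-stat-filter : ∀ {u v a d S γ} → γ ∈ stat-filter u v a d S ⇔ (γ ∈ S × u γ ≡ a × v γ ≡ d)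
∈-stat-filter {u} {v} {a} {d} {S} {γ} = mk⇔ to from
  where
  test : Seq → Bool
  test γ = ⌊ u γ ≟ℤ a ⌋ ∧ ⌊ v γ ≟ℤ d ⌋
  to : γ ∈ stat-filter u v a d S → γ ∈ S × u γ ≡ a × v γ ≡ d
  to p = let (γ∈S , t) = ∈-filter⁻ (T? ∘ test) p ; (tu , tv) = ∧⁻ ⌊ u γ ≟ℤ a ⌋ t
         in γ∈S , toWitness {a? = u γ ≟ℤ a} tu , toWitness {a? = v γ ≟ℤ d} tv
  from : γ ∈ S × u γ ≡ a × v γ ≡ d → γ ∈ stat-filter u v a d S
  from (γ∈S , eu , ev) =
    ∈-filter⁺ (T? ∘ test) γ∈S (∧⁺ (fromWitness {a? = u γ ≟ℤ a} eu) (fromWitness {a? = v γ ≟ℤ d} ev))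

record AreaDinvSwap (m : ℕ) (A′ A : Seq → Set) : Set where
  field
    f             : Seq → Seq
    f-into        : ∀ {δ} → A′ δ → A (f δ)
    f-injective   : ∀ {δ δ′} → A′ δ → A′ δ′ → f δ ≡ f δ′ → δ ≡ δ′
    f-surjective  : ∀ {γ} → A γ → ∃ λ δ → A′ δ × f δ ≡ γ
    dinv-f        : ∀ {δ} → A′ δ → dinv m (f δ) ≡ + area δ
    area-f        : ∀ {δ} → A′ δ → + area (f δ) ≡ dinv m δ

swap⇒coeffQT≡coeffTQ : ∀ {m} Q Q′ {A A′} →
  (∀ {γ} → γ ∈ sub m Q ⇔ A γ) → (∀ {δ} → δ ∈ sub m Q′ ⇔ A′ δ) → AreaDinvSwap m A′ A →
  ∀ a d → coeffQT m (sub m Q) a d ≡ coeffTQ m (sub m Q′) a d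
swap⇒coeffQT≡coeffTQ {m} Q Q′ {A} {A′} ∈A ∈A′ σ a d =
  sym (length-≡-of-bijection (filter-unique {dinv m} {+_ ∘ area} (sub-unique m Q′))
                             (filter-unique {+_ ∘ area} {dinv m} (sub-unique m Q)) f image
        (λ p q → f-injective (A′-of p) (A′-of q)) preimage)
  where
  open AreaDinvSwap σ
  xs ys : List Seq
  xs = stat-filter (+_ ∘ area) (dinv m) a d (sub m Q)
  ys = stat-filter (dinv m) (+_ ∘ area) a d (sub m Q′)
  filter-unique : ∀ {u v S} → Unique S → Unique (stat-filter u v a d S)
  filter-unique {u} {v} = Unique.filter⁺ (T? ∘ (λ γ → ⌊ u γ ≟ℤ a ⌋ ∧ ⌊ v γ ≟ℤ d ⌋))
  ∈xs : ∀ {γ} → γ ∈ xs ⇔ (γ ∈ sub m Q × + area γ ≡ a × dinv m γ ≡ d)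
  ∈xs = ∈-stat-filter {+_ ∘ area} {dinv m} {a} {d} {sub m Q}
  ∈ys : ∀ {δ} → δ ∈ ys ⇔ (δ ∈ sub m Q′ × dinv m δ ≡ a × + area δ ≡ d)
  ∈ys = ∈-stat-filter {dinv m} {+_ ∘ area} {a} {d} {sub m Q′}
  A′-of : ∀ {δ} → δ ∈ ys → A′ δ
  A′-of p = Equivalence.to ∈A′ (proj₁ (Equivalence.to ∈ys p))
  image : ∀ {δ} → δ ∈ ys → f δ ∈ xs
  image p =
    let (δ∈ , dinv≡a , area≡d) = Equivalence.to ∈ys p ; A′δ = Equivalence.to ∈A′ δ∈
    in Equivalence.from ∈xs
         (Equivalence.from ∈A (f-into A′δ) , trans (area-f A′δ) dinv≡a , trans (dinv-f A′δ) area≡d)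
  preimage : ∀ {γ} → γ ∈ xs → ∃ λ δ → δ ∈ ys × f δ ≡ γ
  preimage p with Equivalence.to ∈xs p
  ... | γ∈ , area≡a , dinv≡d with f-surjective (Equivalence.to ∈A γ∈)
  ... | δ , A′δ , refl = δ , Equivalence.from ∈ys
    (Equivalence.from ∈A′ A′δ , trans (sym (area-f A′δ)) area≡a , trans (sym (dinv-f A′δ)) dinv≡d)
    , refl

data D₃ (m : ℕ) : Seq → Set where
  d₃ : ∀ {c e} → c < m → m ≤ e → e ≤ c + m → D₃ m (0 , 0 , c , e)

data D₃′ (m : ℕ) : Seq → Set where
  d₃′ : ∀ {c e} → c ≤ m → m < e → e ≤ c + m → D₃′ m (0 , 0 , c , e)

data Square (m : ℕ) : Seq → Set where
  square : ∀ {c d} → c ≤ m → d ≤ m → Square m (0 , 0 , c , d)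

data D₁₂ (m : ℕ) : Seq → Set where
  d₁ : ∀ {b x} → 0 < b → b ≤ m → m < x → x ≤ b + m → D₁₂ m (0 , b , x , x + m)
  d₂ : ∀ {b e} → b ≤ m → b + m ≤ e → e ≤ m + m → D₁₂ m (0 , b , m , e)

∈D₃ : ∀ {m γ} → γ ∈ sub m (inD3 m) ⇔ D₃ m γ
∈D₃ {m} = ∈-sub-via (inD3 m) to from
  where
  to : ∀ γ → T (inW m γ) × T (inD3 m γ) → D₃ m γ
  to (g₀ , g₁ , c , e) (_ , t)
    with (t₀ , t) ← ∧⁻ (g₀ ℕ.≡ᵇ 0) t
    with (t₁ , t) ← ∧⁻ (g₁ ℕ.≡ᵇ 0) t
    with (t₂ , t) ← ∧⁻ (c ℕ.<ᵇ m) t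
    with (t₃ , t₄) ← ∧⁻ (m ℕ.≤ᵇ e) t
    with refl ← ≡ᵇ⇒≡ g₀ 0 t₀ | refl ← ≡ᵇ⇒≡ g₁ 0 t₁
    = d₃ (<ᵇ⇒< c m t₂) (≤ᵇ⇒≤ m e t₃) (≤ᵇ⇒≤ e _ t₄)
  from : ∀ {γ} → D₃ m γ → T (inW m γ) × T (inD3 m γ)
  from (d₃ c<m m≤e e≤c+m) =
    inW⁺ z≤n (<⇒≤ c<m) e≤c+m , ∧⁺ (<⇒<ᵇ c<m) (∧⁺ (≤⇒≤ᵇ m≤e) (≤⇒≤ᵇ e≤c+m))

∈D₃′ : ∀ {m γ} → γ ∈ sub m (inD3' m) ⇔ D₃′ m γ
∈D₃′ {m} = ∈-sub-via (inD3' m) to from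
  where
  to : ∀ γ → T (inW m γ) × T (inD3' m γ) → D₃′ m γ
  to (g₀ , g₁ , c , e) (w , t)
    with refl , _ , c≤g₁+m , e≤c+m ← inW⁻ {m} {g₀} {g₁} {c} {e} w
    with (t₁ , t₂) ← ∧⁻ (g₁ ℕ.≡ᵇ 0) t
    with refl ← ≡ᵇ⇒≡ g₁ 0 t₁
    = d₃′ c≤g₁+m (<ᵇ⇒< m e t₂) e≤c+m
  from : ∀ {γ} → D₃′ m γ → T (inW m γ) × T (inD3' m γ)
  from (d₃′ c≤m m<e e≤c+m) = inW⁺ z≤n c≤m e≤c+m , <⇒<ᵇ m<e

∈Square : ∀ {m γ} → γ ∈ sub m (λ γ → inD1' m γ ∨ inD2' m γ) ⇔ Square m γ
∈Square {m} = ∈-sub-via (λ γ → inD1' m γ ∨ inD2' m γ) to from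
  where
  to : ∀ γ → T (inW m γ) × T (inD1' m γ ∨ inD2' m γ) → Square m γ
  to (g₀ , g₁ , c , d) (w , t)
    with refl , _ , c≤g₁+m , _ ← inW⁻ {m} {g₀} {g₁} {c} {d} w
    with Equivalence.to (T-∨ {inD1' m (0 , g₁ , c , d)}) t
  ... | inj₁ t with (t₁ , t₂) ← ∧⁻ (g₁ ℕ.≡ᵇ 0) t with refl ← ≡ᵇ⇒≡ g₁ 0 t₁ =
    square c≤g₁+m (≤-trans (<⇒≤ (<ᵇ⇒< d c t₂)) c≤g₁+m)
  ... | inj₂ t with (t₁ , t) ← ∧⁻ (g₁ ℕ.≡ᵇ 0) t with refl ← ≡ᵇ⇒≡ g₁ 0 t₁ =
    square c≤g₁+m (≤ᵇ⇒≤ d m (proj₂ (∧⁻ (c ℕ.≤ᵇ d) t)))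
  from : ∀ {γ} → Square m γ → T (inW m γ) × T (inD1' m γ ∨ inD2' m γ)
  from (square {c} {d} c≤m d≤m) =
    inW⁺ z≤n c≤m (≤-trans d≤m (m≤n+m m c)) , Equivalence.from T-∨ (split (d <? c))
    where
    split : Dec (d < c) → T (d ℕ.<ᵇ c) ⊎ T ((c ℕ.≤ᵇ d) ∧ (d ℕ.≤ᵇ m))
    split (yes d<c) = inj₁ (<⇒<ᵇ d<c)
    split (no d≮c) = inj₂ (∧⁺ (≤⇒≤ᵇ (≮⇒≥ d≮c)) (≤⇒≤ᵇ d≤m))

∈D₁₂ : ∀ {m γ} → γ ∈ sub m (λ γ → inD1 m γ ∨ inD2 m γ) ⇔ D₁₂ m γ
∈D₁₂ {m} = ∈-sub-via (λ γ → inD1 m γ ∨ inD2 m γ) to from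
  where
  2*m≡m+m : 2 * m ≡ m + m
  2*m≡m+m = cong (λ n → m + n) (+-identityʳ m)
  to : ∀ γ → T (inW m γ) × T (inD1 m γ ∨ inD2 m γ) → D₁₂ m γ
  to (g₀ , b , x , e) (_ , t) with Equivalence.to (T-∨ {inD1 m (g₀ , b , x , e)}) t
  ... | inj₁ t
    with (t₀ , t) ← ∧⁻ (g₀ ℕ.≡ᵇ 0) t
    with (t₁ , t) ← ∧⁻ (0 ℕ.<ᵇ b) t
    with (t₂ , t) ← ∧⁻ (b ℕ.≤ᵇ m) t
    with (t₃ , t) ← ∧⁻ (m ℕ.<ᵇ x) t
    with (t₄ , t₅) ← ∧⁻ (x ℕ.≤ᵇ b + m) t
    with refl ← ≡ᵇ⇒≡ g₀ 0 t₀ | refl ← ≡ᵇ⇒≡ e (x + m) t₅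
    = d₁ (<ᵇ⇒< 0 b t₁) (≤ᵇ⇒≤ b m t₂) (<ᵇ⇒< m x t₃) (≤ᵇ⇒≤ x _ t₄)
  ... | inj₂ t
    with (t₀ , t) ← ∧⁻ (g₀ ℕ.≡ᵇ 0) t
    with (t₁ , t) ← ∧⁻ (b ℕ.≤ᵇ m) t
    with (t₂ , t) ← ∧⁻ (x ℕ.≡ᵇ m) t
    with (t₃ , t₄) ← ∧⁻ (b + m ℕ.≤ᵇ e) t
    with refl ← ≡ᵇ⇒≡ g₀ 0 t₀ | refl ← ≡ᵇ⇒≡ x m t₂
    = d₂ (≤ᵇ⇒≤ b m t₁) (≤ᵇ⇒≤ _ e t₃) (subst (e ≤_) 2*m≡m+m (≤ᵇ⇒≤ e _ t₄))
  from : ∀ {γ} → D₁₂ m γ → T (inW m γ) × T (inD1 m γ ∨ inD2 m γ)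
  from (d₁ {b} {x} 0<b b≤m m<x x≤b+m) =
    inW⁺ b≤m x≤b+m ≤-refl ,
    Equivalence.from (T-∨ {inD1 m (0 , b , x , x + m)}) (inj₁
      (∧⁺ (<⇒<ᵇ 0<b) (∧⁺ (≤⇒≤ᵇ b≤m) (∧⁺ (<⇒<ᵇ m<x)
        (∧⁺ (≤⇒≤ᵇ x≤b+m) (≡⇒≡ᵇ (x + m) _ refl))))))
  from (d₂ {b} {e} b≤m b+m≤e e≤2m) =
    inW⁺ b≤m (m≤n+m m b) e≤2m ,
    Equivalence.from (T-∨ {inD1 m (0 , b , m , e)}) (inj₂
      (∧⁺ (≤⇒≤ᵇ b≤m) (∧⁺ (≡⇒≡ᵇ m m refl)
        (∧⁺ (≤⇒≤ᵇ b+m≤e) (≤⇒≤ᵇ (subst (e ≤_) (sym 2*m≡m+m) e≤2m))))))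

-- Values of dinv

pos-∸ : ∀ {m n} → n ≤ m → + (m ∸ n) ≡ + m ℤ.- + n
pos-∸ {m} {n} n≤m = sym (trans (ZP.m-n≡m⊖n m n) (ZP.⊖-≥ n≤m))

neg-∸ : ∀ {m n} → m ≤ n → + m ℤ.- + n ≡ ℤ.- + (n ∸ m)
neg-∸ {m} {n} m≤n = trans (ZP.m-n≡m⊖n m n) (ZP.⊖-≤ m≤n)

1≰-n : ∀ n → ¬ (+ 1 ℤ.≤ ℤ.- + n)
1≰-n n 1≤-n with ZP.≤-trans 1≤-n (ZP.neg-mono-≤ (ℤ.+≤+ (z≤n {n})))
... | ℤ.+≤+ ()

record Band (m c e : ℕ) : Set where
  constructor band
  field
    lower  : c ≤ m
    middle : m ≤ e
    upper  : e ≤ c + m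

κ : ℕ → ℕ → ℕ
κ c d with d <? c
... | yes _ = c + c
... | no  _ = suc (d + d)

lastEntry : Seq → ℕ
lastEntry (_ , _ , _ , g₃) = g₃

module _ (m : ℕ) where

  sc-pos : ∀ {x y} → y < x → x ≤ y + m → sc m (+ x ℤ.- + y) ≡ (+ m ℤ.+ + 1) ℤ.- (+ x ℤ.- + y)
  sc-pos {x} {y} y<x x≤y+m
    rewrite ⌊⌋-true (+ 1 ≤ℤ? (+ x ℤ.- + y))
              (subst (+ 1 ℤ.≤_) (pos-∸ (<⇒≤ y<x)) (ℤ.+≤+ (m<n⇒0<n∸m y<x)))
          | ⌊⌋-true ((+ x ℤ.- + y) ≤ℤ? + m)
              (subst (ℤ._≤ + m) (pos-∸ (<⇒≤ y<x)) (ℤ.+≤+ (m≤n+o⇒m∸n≤o x y x≤y+m)))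
          = refl

  sc-nonpos : ∀ {x y} → x ≤ y → y ≤ x + m → sc m (+ x ℤ.- + y) ≡ + m ℤ.+ (+ x ℤ.- + y)
  sc-nonpos {x} {y} x≤y y≤x+m
    rewrite neg-∸ x≤y
          | ⌊⌋-false (+ 1 ≤ℤ? ℤ.- + (y ∸ x)) (1≰-n (y ∸ x))
          | ⌊⌋-true (ℤ.- + m ≤ℤ? ℤ.- + (y ∸ x)) (ZP.neg-mono-≤ (ℤ.+≤+ (m≤n+o⇒m∸n≤o y x y≤x+m)))
          | ⌊⌋-true (ℤ.- + (y ∸ x) ≤ℤ? + 0) (ZP.neg-mono-≤ (ℤ.+≤+ z≤n))
          = refl

  sc-far : ∀ {x y} → x + m ≤ y → sc m (+ x ℤ.- + y) ≡ + 0
  sc-far {x} {y} x+m≤y with m≤n⇒m<n∨m≡n x+m≤y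
  ... | inj₂ refl = begin
    sc m (+ x ℤ.- + (x + m))       ≡⟨ sc-nonpos (m≤m+n x m) ≤-refl ⟩
    + m ℤ.+ (+ x ℤ.- + (x + m))    ≡⟨ cong (λ z → + m ℤ.+ z) (neg-∸ (m≤m+n x m)) ⟩
    + m ℤ.+ ℤ.- + (x + m ∸ x)      ≡⟨ cong (λ z → + m ℤ.+ ℤ.- + z) (m+n∸m≡n x m) ⟩
    + m ℤ.+ ℤ.- + m                ≡⟨ ZP.+-inverseʳ (+ m) ⟩
    + 0                            ∎
    where open ≡-Reasoning
  ... | inj₁ x+m<y
    rewrite neg-∸ (≤-trans (m≤m+n x m) x+m≤y)
          | ⌊⌋-false (+ 1 ≤ℤ? ℤ.- + (y ∸ x)) (1≰-n (y ∸ x))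
          | ⌊⌋-false (ℤ.- + m ≤ℤ? ℤ.- + (y ∸ x))
              (λ q → <⇒≱ (m+n≤o⇒m≤o∸n (suc m) (subst (λ z → suc z ≤ y) (+-comm x m) x+m<y))
                         (ZP.drop‿+≤+ (ZP.neg-cancel-≤ q)))
          = refl

  dinv-six : ∀ {a b c d v₁ v₂ v₃ v₄ v₅ v₆} →
    sc m (+ a ℤ.- + b) ≡ v₁ → sc m (+ a ℤ.- + c) ≡ v₂ → sc m (+ a ℤ.- + d) ≡ v₃ →
    sc m (+ b ℤ.- + c) ≡ v₄ → sc m (+ b ℤ.- + d) ≡ v₅ → sc m (+ c ℤ.- + d) ≡ v₆ →
    dinv m (a , b , c , d) ≡ v₁ ℤ.+ v₂ ℤ.+ v₃ ℤ.+ v₄ ℤ.+ v₅ ℤ.+ v₆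
  dinv-six refl refl refl refl refl refl = refl

  -- The summands on the left of each `total` are the values of sc on the six pairs; instantiated
  -- at M = + m, C = + c, ... both sides reduce to the statement, as ℤ addition of naturals computes.
  dinv-band : ∀ {c e} → Band m c e → dinv m (0 , 0 , c , e) ℤ.+ + (c + e) ≡ + (m + m + (m + m))
  dinv-band {c} {e} (band c≤m m≤e e≤c+m) =
    trans (cong (ℤ._+ + (c + e))
            (dinv-six {0} {0} {c} {e} (sc-nonpos z≤n z≤n) (sc-nonpos z≤n c≤m) (sc-far m≤e)
                      (sc-nonpos z≤n c≤m) (sc-far m≤e) (sc-nonpos (≤-trans c≤m m≤e) e≤c+m)))
          (total (+ m) (+ c) (+ e))
    where
    total : ∀ M C E →
      (M ℤ.+ (+ 0 ℤ.- + 0)) ℤ.+ (M ℤ.+ (+ 0 ℤ.- C)) ℤ.+ + 0 ℤ.+ (M ℤ.+ (+ 0 ℤ.- C)) ℤ.+ + 0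
        ℤ.+ (M ℤ.+ (C ℤ.- E)) ℤ.+ (C ℤ.+ E) ≡ M ℤ.+ M ℤ.+ (M ℤ.+ M)
    total = ℤSolver.solve-∀

  dinv-square : ∀ {c d} → c ≤ m → d ≤ m →
    dinv m (0 , 0 , c , d) ℤ.+ + (c + d + κ c d) ≡ + suc (m + m + m + (m + m + m))
  dinv-square {c} {d} c≤m d≤m with d <? c
  ... | yes d<c =
    trans (cong (ℤ._+ + (c + d + (c + c)))
            (dinv-six {0} {0} {c} {d} (sc-nonpos z≤n z≤n) (sc-nonpos z≤n c≤m) (sc-nonpos z≤n d≤m)
                      (sc-nonpos z≤n c≤m) (sc-nonpos z≤n d≤m) (sc-pos d<c (≤-trans c≤m (m≤n+m m d)))))
          (total (+ m) (+ c) (+ d))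
    where
    total : ∀ M C D →
      (M ℤ.+ (+ 0 ℤ.- + 0)) ℤ.+ (M ℤ.+ (+ 0 ℤ.- C)) ℤ.+ (M ℤ.+ (+ 0 ℤ.- D)) ℤ.+ (M ℤ.+ (+ 0 ℤ.- C))
        ℤ.+ (M ℤ.+ (+ 0 ℤ.- D)) ℤ.+ ((M ℤ.+ + 1) ℤ.- (C ℤ.- D)) ℤ.+ (C ℤ.+ D ℤ.+ (C ℤ.+ C))
        ≡ + 1 ℤ.+ (M ℤ.+ M ℤ.+ M ℤ.+ (M ℤ.+ M ℤ.+ M))
    total = ℤSolver.solve-∀
  ... | no d≮c =
    trans (cong (ℤ._+ + (c + d + suc (d + d)))
            (dinv-six {0} {0} {c} {d} (sc-nonpos z≤n z≤n) (sc-nonpos z≤n c≤m) (sc-nonpos z≤n d≤m)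
                      (sc-nonpos z≤n c≤m) (sc-nonpos z≤n d≤m) (sc-nonpos (≮⇒≥ d≮c) (≤-trans d≤m (m≤n+m m c)))))
          (total (+ m) (+ c) (+ d))
    where
    total : ∀ M C D →
      (M ℤ.+ (+ 0 ℤ.- + 0)) ℤ.+ (M ℤ.+ (+ 0 ℤ.- C)) ℤ.+ (M ℤ.+ (+ 0 ℤ.- D)) ℤ.+ (M ℤ.+ (+ 0 ℤ.- C))
        ℤ.+ (M ℤ.+ (+ 0 ℤ.- D)) ℤ.+ (M ℤ.+ (C ℤ.- D)) ℤ.+ (C ℤ.+ D ℤ.+ (+ 1 ℤ.+ (D ℤ.+ D)))
        ≡ + 1 ℤ.+ (M ℤ.+ M ℤ.+ M ℤ.+ (M ℤ.+ M ℤ.+ M))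
    total = ℤSolver.solve-∀

  dinv-D₁₂ : ∀ {γ} → D₁₂ m γ → dinv m γ ℤ.+ + lastEntry γ ≡ + (m + m + m)
  dinv-D₁₂ (d₁ {b} {x} _ b≤m m<x x≤b+m) =
    trans (cong (ℤ._+ + (x + m))
            (dinv-six {0} {b} {x} {x + m} (sc-nonpos z≤n b≤m) (sc-far (<⇒≤ m<x)) (sc-far (m≤n+m m x))
                      (sc-nonpos (≤-trans b≤m (<⇒≤ m<x)) x≤b+m) (sc-far (+-monoˡ-≤ m (≤-trans b≤m (<⇒≤ m<x))))
                      (sc-far {x} ≤-refl)))
          (total (+ m) (+ b) (+ x))
    where
    total : ∀ M B X →
      (M ℤ.+ (+ 0 ℤ.- B)) ℤ.+ + 0 ℤ.+ + 0 ℤ.+ (M ℤ.+ (B ℤ.- X)) ℤ.+ + 0 ℤ.+ + 0 ℤ.+ (X ℤ.+ M)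
        ≡ M ℤ.+ M ℤ.+ M
    total = ℤSolver.solve-∀
  dinv-D₁₂ (d₂ {b} {e} b≤m b+m≤e e≤2m) =
    trans (cong (ℤ._+ + e)
            (dinv-six {0} {b} {m} {e} (sc-nonpos z≤n b≤m) (sc-nonpos z≤n ≤-refl) (sc-far m≤e)
                      (sc-nonpos b≤m (m≤n+m m b)) (sc-far b+m≤e) (sc-nonpos m≤e e≤2m)))
          (total (+ m) (+ b) (+ e))
    where
    m≤e : m ≤ e
    m≤e = ≤-trans (m≤n+m m b) b+m≤e
    total : ∀ M B E →
      (M ℤ.+ (+ 0 ℤ.- B)) ℤ.+ (M ℤ.+ (+ 0 ℤ.- M)) ℤ.+ + 0 ℤ.+ (M ℤ.+ (B ℤ.- M)) ℤ.+ + 0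
        ℤ.+ (M ℤ.+ (M ℤ.- E)) ℤ.+ E ≡ M ℤ.+ M ℤ.+ M
    total = ℤSolver.solve-∀

-- The formulas for dinv have the shape dinv + X = N with X and N natural, so that what follows
-- them is arithmetic in ℕ.
dinv-from-sum : ∀ {m γ X N n} → dinv m γ ℤ.+ + X ≡ + N → n + X ≡ N → dinv m γ ≡ + n
dinv-from-sum {X = X} h refl = ∙-cancelʳ (+ X) _ _ h

-- The second identity

reflect : ℕ → Seq → Seq
reflect m (_ , _ , c , e) = (0 , 0 , m + m ∸ e , m + m ∸ c)

complement-sum : ∀ {c e c′ e′ n} → c′ + e ≡ n → e′ + c ≡ n → c + e + (c′ + e′) ≡ n + n
complement-sum {c} {e} {c′} {e′} {n} c′+e≡n e′+c≡n = begin
  c + e + (c′ + e′)   ≡⟨ solve (c L.∷ e L.∷ c′ L.∷ e′ L.∷ L.[]) ⟩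
  c′ + e + (e′ + c)   ≡⟨ cong₂ _+_ c′+e≡n e′+c≡n ⟩
  n + n               ∎
  where open ≡-Reasoning

module Reflection {m c e : ℕ} (b : Band m c e) where
  open Band b

  private
    c′ e′ : ℕ
    c′ = m + m ∸ e
    e′ = m + m ∸ c
    e≤2m : e ≤ m + m
    e≤2m = ≤-trans upper (+-monoˡ-≤ m lower)
    c≤2m : c ≤ m + m
    c≤2m = ≤-trans lower (m≤m+n m m)

  reflect-Band : Band m c′ e′
  reflect-Band = band
    (m≤n+o⇒m∸n≤o (m + m) e (+-monoˡ-≤ m middle))
    (m+n≤o⇒m≤o∸n m (+-monoʳ-≤ m lower))
    (m≤n+o⇒m∸n≤o (m + m) c (begin
      m + m          ≡⟨ m∸n+n≡m e≤2m ⟨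
      c′ + e         ≤⟨ +-monoʳ-≤ c′ upper ⟩
      c′ + (c + m)   ≡⟨ x∙yz≈y∙xz c′ c m ⟩
      c + (c′ + m)   ∎))
    where open ≤-Reasoning

  reflect-involutive : reflect m (reflect m (0 , 0 , c , e)) ≡ (0 , 0 , c , e)
  reflect-involutive = cong₂ (λ x y → (0 , 0 , x , y)) (m∸[m∸n]≡n c≤2m) (m∸[m∸n]≡n e≤2m)

  reflect-<ˡ : c < m → m < e′
  reflect-<ˡ c<m = m+n≤o⇒m≤o∸n (suc m) (subst (ℕ._≤ m + m) (+-suc m c) (+-monoʳ-≤ m c<m))

  reflect-<ʳ : m < e → c′ < m
  reflect-<ʳ m<e = subst (c′ <_) (m+n∸n≡m m m) (∸-monoʳ-< m<e e≤2m)

  dinv-reflect : dinv m (reflect m (0 , 0 , c , e)) ≡ + area (0 , 0 , c , e)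
  dinv-reflect = dinv-from-sum {m} {reflect m (0 , 0 , c , e)} (dinv-band m reflect-Band)
    (complement-sum {c} {e} (m∸n+n≡m e≤2m) (m∸n+n≡m c≤2m))

  area-reflect : + area (reflect m (0 , 0 , c , e)) ≡ dinv m (0 , 0 , c , e)
  area-reflect = sym (dinv-from-sum {m} {0 , 0 , c , e} (dinv-band m b)
    (trans (+-comm (c′ + e′) (c + e)) (complement-sum {c} {e} (m∸n+n≡m e≤2m) (m∸n+n≡m c≤2m))))

reflect-swap : ∀ m → AreaDinvSwap m (D₃′ m) (D₃ m)
reflect-swap m = record
  { f            = reflect m
  ; f-into       = into
  ; f-injective  = λ p q eq → trans (sym (involutive p)) (trans (cong (reflect m) eq) (involutive q))
  ; f-surjective = surjective
  ; dinv-f       = λ { (d₃′ c≤m m<e e≤c+m) → Reflection.dinv-reflect (band c≤m (<⇒≤ m<e) e≤c+m) }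
  ; area-f       = λ { (d₃′ c≤m m<e e≤c+m) → Reflection.area-reflect (band c≤m (<⇒≤ m<e) e≤c+m) }
  }
  where
  into : ∀ {δ} → D₃′ m δ → D₃ m (reflect m δ)
  into (d₃′ c≤m m<e e≤c+m) = d₃ (reflect-<ʳ m<e) (Band.middle reflect-Band) (Band.upper reflect-Band)
    where open Reflection (band c≤m (<⇒≤ m<e) e≤c+m)
  involutive : ∀ {δ} → D₃′ m δ → reflect m (reflect m δ) ≡ δ
  involutive (d₃′ c≤m m<e e≤c+m) = Reflection.reflect-involutive (band c≤m (<⇒≤ m<e) e≤c+m)
  surjective : ∀ {γ} → D₃ m γ → ∃ λ δ → D₃′ m δ × reflect m δ ≡ γ
  surjective (d₃ c<m m≤e e≤c+m) =
    _ , d₃′ (Band.lower reflect-Band) (reflect-<ˡ c<m) (Band.upper reflect-Band) , reflect-involutive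
    where open Reflection (band (<⇒≤ c<m) m≤e e≤c+m)

-- The first identity

halve : ∀ k → ∃ λ h → k ≡ h + h ⊎ k ≡ suc (h + h)
halve zero = 0 , inj₁ refl
halve (suc k) with halve k
... | h , inj₁ refl = h , inj₂ refl
... | h , inj₂ refl = suc h , inj₁ (cong suc (sym (+-suc h h)))

m+m≢1+n+n : ∀ m n → m + m ≢ suc (n + n)
m+m≢1+n+n zero n ()
m+m≢1+n+n (suc m) zero eq rewrite +-suc m m = contradiction (suc-injective eq) λ ()
m+m≢1+n+n (suc m) (suc n) eq rewrite +-suc m m | +-suc n n = m+m≢1+n+n m n (suc-injective (suc-injective eq))

m+m≤1+n+n⇒m≤n : ∀ {m n} → m + m ≤ suc (n + n) → m ≤ n
m+m≤1+n+n⇒m≤n {m} {n} 2m≤2n+1 with m ℕ.≤? n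
... | yes m≤n = m≤n
... | no m≰n = contradiction 2m≤2n+1
  (<⇒≱ (subst (ℕ._≤ m + m) (cong suc (+-suc n n)) (+-mono-≤ n<m n<m)))
  where n<m = ≰⇒> m≰n

m+m≡n+n⇒m≡n : ∀ {m n} → m + m ≡ n + n → m ≡ n
m+m≡n+n⇒m≡n eq = ≤-antisym (m+m≤1+n+n⇒m≤n (m≤n⇒m≤1+n (≤-reflexive eq)))
                           (m+m≤1+n+n⇒m≤n (m≤n⇒m≤1+n (≤-reflexive (sym eq))))

data Code (m : ℕ) : ℕ × ℕ → Set where
  code : ∀ {s k} → s < k → k ≤ suc (s + s) → k ≤ suc (m + m) → Code m (s , k)

encode : Seq → ℕ × ℕ
encode (_ , _ , c , d) = c + d , κ c d

κ-< : ∀ {c d} → d < c → κ c d ≡ c + c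
κ-< {c} {d} d<c with d <? c
... | yes _ = refl
... | no d≮c = contradiction d<c d≮c

κ-≥ : ∀ {c d} → c ≤ d → κ c d ≡ suc (d + d)
κ-≥ {c} {d} c≤d with d <? c
... | yes d<c = contradiction c≤d (<⇒≱ d<c)
... | no _ = refl

encode-Code : ∀ {m δ} → Square m δ → Code m (encode δ)
encode-Code (square {c} {d} c≤m d≤m) with d <? c
... | yes d<c = code (+-monoʳ-< c d<c)
                    (m≤n⇒m≤1+n (+-mono-≤ (m≤m+n c d) (m≤m+n c d)))
                    (m≤n⇒m≤1+n (+-mono-≤ c≤m c≤m))
... | no d≮c  = code (s≤s (+-monoˡ-≤ d (≮⇒≥ d≮c)))
                    (s≤s (+-mono-≤ (m≤n+m d c) (m≤n+m d c)))
                    (s≤s (+-mono-≤ d≤m d≤m))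

encode-injective : ∀ {m δ δ′} → Square m δ → Square m δ′ → encode δ ≡ encode δ′ → δ ≡ δ′
encode-injective (square {c} {d} _ _) (square {c′} {d′} _ _) eq
  with d <? c | d′ <? c′ | cong proj₁ eq | cong proj₂ eq
... | yes _ | yes _ | s≡s′ | 2c≡2c′ with refl ← m+m≡n+n⇒m≡n {c} {c′} 2c≡2c′ =
  cong (λ z → (0 , 0 , c , z)) (+-cancelˡ-≡ c d d′ s≡s′)
... | no _ | no _ | s≡s′ | 2d+1≡2d′+1 with refl ← m+m≡n+n⇒m≡n {d} {d′} (suc-injective 2d+1≡2d′+1) =
  cong (λ z → (0 , 0 , z , d)) (+-cancelʳ-≡ d c c′ s≡s′)
... | yes _ | no _ | _ | even≡odd = contradiction even≡odd (m+m≢1+n+n c d′)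
... | no _ | yes _ | _ | odd≡even = contradiction (sym odd≡even) (m+m≢1+n+n c′ d)

encode-surjective : ∀ {m p} → Code m p → ∃ λ δ → Square m δ × encode δ ≡ p
encode-surjective {m} (code {s} {k} s<k k≤2s+1 k≤2m+1) with halve k
... | h , inj₁ refl =
  (0 , 0 , h , s ∸ h) , square h≤m (≤-trans (<⇒≤ d<h) h≤m) , cong₂ _,_ (m+[n∸m]≡n h≤s) (κ-< d<h)
  where
  h≤s : h ≤ s
  h≤s = m+m≤1+n+n⇒m≤n k≤2s+1
  h≤m : h ≤ m
  h≤m = m+m≤1+n+n⇒m≤n k≤2m+1
  d<h : s ∸ h < h
  d<h = +-cancelʳ-≤ h _ h (subst (λ z → suc z ≤ h + h) (sym (m∸n+n≡m h≤s)) s<k)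
... | h , inj₂ refl =
  (0 , 0 , s ∸ h , h) , square (≤-trans c≤h h≤m) h≤m , cong₂ _,_ (m∸n+n≡m h≤s) (κ-≥ c≤h)
  where
  h≤s : h ≤ s
  h≤s = m+m≤1+n+n⇒m≤n (m≤n⇒m≤1+n (ℕ.s≤s⁻¹ k≤2s+1))
  h≤m : h ≤ m
  h≤m = m+m≤1+n+n⇒m≤n (m≤n⇒m≤1+n (ℕ.s≤s⁻¹ k≤2m+1))
  c≤h : s ∸ h ≤ h
  c≤h = +-cancelʳ-≤ h _ h (subst (ℕ._≤ h + h) (sym (m∸n+n≡m h≤s)) (ℕ.s≤s⁻¹ s<k))

decode : ℕ → ℕ × ℕ → Seq
decode m (s , k) with s <? m
... | yes _ = (0 , suc (s + m) ∸ k , m + m ∸ s , m + m + m ∸ s)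
... | no  _ = (0 , suc (m + m) ∸ k , m , m + m + m ∸ s)

Code⇒D₁ : ∀ {m s k b x} → s < m → s < k → k ≤ suc (s + s) →
  b + k ≡ suc (s + m) → x + s ≡ m + m → D₁₂ m (0 , b , x , x + m)
Code⇒D₁ {m} {s} {k} {b} {x} s<m s<k k≤2s+1 b+k≡ x+s≡ = d₁ 0<b b≤m m<x x≤b+m
  where
  open ≤-Reasoning
  0<b : 0 < b
  0<b = +-cancelʳ-≤ k 1 b (begin
    suc k         ≤⟨ s≤s (≤-trans k≤2s+1 (subst (_≤ s + m) (+-suc s s) (+-monoʳ-≤ s s<m))) ⟩
    suc (s + m)   ≡⟨ b+k≡ ⟨
    b + k         ∎)
  b≤m : b ≤ m
  b≤m = +-cancelʳ-≤ k b m (begin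
    b + k         ≡⟨ b+k≡ ⟩
    suc s + m     ≤⟨ +-monoˡ-≤ m s<k ⟩
    k + m         ≡⟨ +-comm k m ⟩
    m + k         ∎)
  m<x : m < x
  m<x = +-cancelʳ-≤ s (suc m) x (begin
    suc m + s     ≡⟨ +-suc m s ⟨
    m + suc s     ≤⟨ +-monoʳ-≤ m s<m ⟩
    m + m         ≡⟨ x+s≡ ⟨
    x + s         ∎)
  x≤b+m : x ≤ b + m
  x≤b+m = +-cancelʳ-≤ (s + k) x (b + m) (begin
    x + (s + k)            ≡⟨ +-assoc x s k ⟨
    x + s + k              ≡⟨ cong (_+ k) x+s≡ ⟩
    m + m + k              ≤⟨ +-monoʳ-≤ (m + m) k≤2s+1 ⟩
    m + m + suc (s + s)    ≡⟨ solve (m L.∷ s L.∷ L.[]) ⟩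
    suc (s + m) + (m + s)  ≡⟨ cong (_+ (m + s)) b+k≡ ⟨
    b + k + (m + s)        ≡⟨ solve (b L.∷ k L.∷ m L.∷ s L.∷ L.[]) ⟩
    b + m + (s + k)        ∎)

Code⇒D₂ : ∀ {m s k b e} → m ≤ s → s < k →
  b + k ≡ suc (m + m) → e + s ≡ m + m + m → D₁₂ m (0 , b , m , e)
Code⇒D₂ {m} {s} {k} {b} {e} m≤s s<k b+k≡ e+s≡ = d₂ b≤m b+m≤e e≤2m
  where
  open ≤-Reasoning
  b≤m : b ≤ m
  b≤m = +-cancelʳ-≤ k b m (begin
    b + k         ≡⟨ b+k≡ ⟩
    suc m + m     ≤⟨ +-monoˡ-≤ m (≤-<-trans m≤s s<k) ⟩
    k + m         ≡⟨ +-comm k m ⟩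
    m + k         ∎)
  b+m≤e : b + m ≤ e
  b+m≤e = +-cancelʳ-≤ (s + k) (b + m) e (begin
    b + m + (s + k)          ≡⟨ solve (b L.∷ m L.∷ s L.∷ k L.∷ L.[]) ⟩
    b + k + (m + s)          ≡⟨ cong (_+ (m + s)) b+k≡ ⟩
    suc (m + m) + (m + s)    ≡⟨ solve (m L.∷ s L.∷ L.[]) ⟩
    m + m + m + suc s        ≤⟨ +-monoʳ-≤ (m + m + m) s<k ⟩
    m + m + m + k            ≡⟨ cong (_+ k) e+s≡ ⟨
    e + s + k                ≡⟨ +-assoc e s k ⟩
    e + (s + k)              ∎)
  e≤2m : e ≤ m + m
  e≤2m = +-cancelʳ-≤ s e (m + m) (begin
    e + s         ≡⟨ e+s≡ ⟩
    m + m + m     ≤⟨ +-monoʳ-≤ (m + m) m≤s ⟩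
    m + m + s     ∎)

D₁⇒Code : ∀ {m s k b x} → b ≤ m → m < x → x ≤ b + m →
  s + x ≡ m + m → k + b ≡ suc (s + m) → s < m × Code m (s , k)
D₁⇒Code {m} {s} {k} {b} {x} b≤m m<x x≤b+m s+x≡ k+b≡ = s<m , code s<k k≤2s+1 k≤2m+1
  where
  open ≤-Reasoning
  s<m : s < m
  s<m = +-cancelʳ-≤ x (suc s) m (begin
    suc s + x     ≡⟨ cong suc s+x≡ ⟩
    suc m + m     ≤⟨ +-monoˡ-≤ m m<x ⟩
    x + m         ≡⟨ +-comm x m ⟩
    m + x         ∎)
  s<k : s < k
  s<k = +-cancelʳ-≤ b (suc s) k (begin
    suc (s + b)   ≤⟨ s≤s (+-monoʳ-≤ s b≤m) ⟩
    suc (s + m)   ≡⟨ k+b≡ ⟨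
    k + b         ∎)
  m≤s+b : m ≤ s + b
  m≤s+b = +-cancelʳ-≤ m m (s + b) (begin
    m + m         ≡⟨ s+x≡ ⟨
    s + x         ≤⟨ +-monoʳ-≤ s x≤b+m ⟩
    s + (b + m)   ≡⟨ +-assoc s b m ⟨
    s + b + m     ∎)
  k≤2s+1 : k ≤ suc (s + s)
  k≤2s+1 = +-cancelʳ-≤ b k (suc (s + s)) (begin
    k + b               ≡⟨ k+b≡ ⟩
    suc (s + m)         ≤⟨ s≤s (+-monoʳ-≤ s m≤s+b) ⟩
    suc (s + (s + b))   ≡⟨ cong suc (+-assoc s s b) ⟨
    suc (s + s) + b     ∎)
  k≤2m+1 : k ≤ suc (m + m)
  k≤2m+1 = +-cancelʳ-≤ b k (suc (m + m)) (begin
    k + b               ≡⟨ k+b≡ ⟩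
    suc (s + m)         ≤⟨ s≤s (+-monoˡ-≤ m (<⇒≤ s<m)) ⟩
    suc (m + m)         ≤⟨ m≤m+n _ b ⟩
    suc (m + m) + b     ∎)

D₂⇒Code : ∀ {m s k b e} → b + m ≤ e → e ≤ m + m →
  s + e ≡ m + m + m → k + b ≡ suc (m + m) → m ≤ s × Code m (s , k)
D₂⇒Code {m} {s} {k} {b} {e} b+m≤e e≤2m s+e≡ k+b≡ = m≤s , code s<k k≤2s+1 k≤2m+1
  where
  open ≤-Reasoning
  m≤s : m ≤ s
  m≤s = +-cancelʳ-≤ e m s (begin
    m + e         ≤⟨ +-monoʳ-≤ m e≤2m ⟩
    m + (m + m)   ≡⟨ +-assoc m m m ⟨
    m + m + m     ≡⟨ s+e≡ ⟨
    s + e         ∎)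
  s+b≤2m : s + b ≤ m + m
  s+b≤2m = +-cancelʳ-≤ e (s + b) (m + m) (begin
    s + b + e         ≡⟨ solve (s L.∷ b L.∷ e L.∷ L.[]) ⟩
    s + e + b         ≡⟨ cong (_+ b) s+e≡ ⟩
    m + m + m + b     ≡⟨ solve (m L.∷ b L.∷ L.[]) ⟩
    m + m + (b + m)   ≤⟨ +-monoʳ-≤ (m + m) b+m≤e ⟩
    m + m + e         ∎)
  s<k : s < k
  s<k = +-cancelʳ-≤ b (suc s) k (begin
    suc (s + b)   ≤⟨ s≤s s+b≤2m ⟩
    suc (m + m)   ≡⟨ k+b≡ ⟨
    k + b         ∎)
  k≤2s+1 : k ≤ suc (s + s)
  k≤2s+1 = +-cancelʳ-≤ b k (suc (s + s)) (begin
    k + b             ≡⟨ k+b≡ ⟩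
    suc (m + m)       ≤⟨ s≤s (+-mono-≤ m≤s m≤s) ⟩
    suc (s + s)       ≤⟨ m≤m+n _ b ⟩
    suc (s + s) + b   ∎)
  k≤2m+1 : k ≤ suc (m + m)
  k≤2m+1 = ≤-trans (m≤m+n k b) (≤-reflexive k+b≡)

module _ {m s k : ℕ} where

  decode-below : s < m → decode m (s , k) ≡ (0 , suc (s + m) ∸ k , m + m ∸ s , m + m + m ∸ s)
  decode-below s<m with s <? m
  ... | yes _ = refl
  ... | no s≮m = contradiction s<m s≮m

  decode-above : m ≤ s → decode m (s , k) ≡ (0 , suc (m + m) ∸ k , m , m + m + m ∸ s)
  decode-above m≤s with s <? m
  ... | yes s<m = contradiction m≤s (<⇒≱ s<m)
  ... | no _ = refl

  lastEntry-decode : lastEntry (decode m (s , k)) ≡ m + m + m ∸ s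
  lastEntry-decode with s <? m
  ... | yes _ = refl
  ... | no _ = refl

  Code⇒s≤2m : Code m (s , k) → s ≤ m + m
  Code⇒s≤2m (code s<k _ k≤2m+1) = ℕ.s≤s⁻¹ (≤-trans s<k k≤2m+1)

  Code⇒s≤3m : Code m (s , k) → s ≤ m + m + m
  Code⇒s≤3m c = ≤-trans (Code⇒s≤2m c) (m≤m+n (m + m) m)

  Code⇒k≤1+s+m : s < m → Code m (s , k) → k ≤ suc (s + m)
  Code⇒k≤1+s+m s<m (code _ k≤2s+1 _) = ≤-trans k≤2s+1 (s≤s (+-monoʳ-≤ s (<⇒≤ s<m)))

decode-D₁₂ : ∀ {m p} → Code m p → D₁₂ m (decode m p)
decode-D₁₂ {m} c@(code {s} {k} s<k k≤2s+1 k≤2m+1) with s <? m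
... | yes s<m =
  subst (λ e → D₁₂ m (0 , suc (s + m) ∸ k , m + m ∸ s , e)) (sym (+-∸-comm m (Code⇒s≤2m c)))
    (Code⇒D₁ s<m s<k k≤2s+1 (m∸n+n≡m (Code⇒k≤1+s+m s<m c)) (m∸n+n≡m (Code⇒s≤2m c)))
... | no s≮m =
  Code⇒D₂ (≮⇒≥ s≮m) s<k (m∸n+n≡m k≤2m+1) (m∸n+n≡m (Code⇒s≤3m c))

decode-injective : ∀ {m p p′} → Code m p → Code m p′ → decode m p ≡ decode m p′ → p ≡ p′
decode-injective {m} c@(code {s} {k} _ _ k≤2m+1) c′@(code {s′} {k′} _ _ k′≤2m+1) eq
  with refl ← ∸-cancelˡ-≡ (Code⇒s≤3m c) (Code⇒s≤3m c′)
                (trans (sym (lastEntry-decode {m} {s} {k}))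
                       (trans (cong lastEntry eq) (lastEntry-decode {m} {s′} {k′})))
  with s <? m | cong (proj₁ ∘ proj₂) eq
... | yes s<m | b≡b′ = cong (s ,_) (∸-cancelˡ-≡ (Code⇒k≤1+s+m s<m c) (Code⇒k≤1+s+m s<m c′) b≡b′)
... | no _    | b≡b′ = cong (s ,_) (∸-cancelˡ-≡ k≤2m+1 k′≤2m+1 b≡b′)

decode-surjective : ∀ {m γ} → D₁₂ m γ → ∃ λ p → Code m p × decode m p ≡ γ
decode-surjective {m} (d₁ {b} {x} _ b≤m m<x x≤b+m) =
  (s , k) , Code-k , (begin
    decode m (s , k)
      ≡⟨ decode-below s<m ⟩
    (0 , suc (s + m) ∸ k , m + m ∸ s , m + m + m ∸ s)
      ≡⟨ cong₂ (λ b′ x′ → (0 , b′ , x′)) (m∸[m∸n]≡n b≤s+m+1) (cong₂ _,_ x′≡x e′≡x+m) ⟩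
    (0 , b , x , x + m)
      ∎)
  where
  open ≡-Reasoning
  x≤2m : x ≤ m + m
  x≤2m = ≤-trans x≤b+m (+-monoˡ-≤ m b≤m)
  s k : ℕ
  s = m + m ∸ x
  b≤s+m+1 : b ≤ suc (s + m)
  b≤s+m+1 = m≤n⇒m≤1+n (≤-trans b≤m (m≤n+m m s))
  k = suc (s + m) ∸ b
  s<m×Code-k = D₁⇒Code b≤m m<x x≤b+m (m∸n+n≡m x≤2m) (m∸n+n≡m b≤s+m+1)
  s<m = proj₁ s<m×Code-k
  Code-k = proj₂ s<m×Code-k
  x′≡x : m + m ∸ s ≡ x
  x′≡x = m∸[m∸n]≡n x≤2m
  e′≡x+m : m + m + m ∸ s ≡ x + m
  e′≡x+m = trans (+-∸-comm m (m∸n≤m (m + m) x)) (cong (_+ m) x′≡x)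
decode-surjective {m} (d₂ {b} {e} b≤m b+m≤e e≤2m) =
  (s , k) , Code-k , (begin
    decode m (s , k)
      ≡⟨ decode-above m≤s ⟩
    (0 , suc (m + m) ∸ k , m , m + m + m ∸ s)
      ≡⟨ cong₂ (λ b′ e′ → (0 , b′ , m , e′)) (m∸[m∸n]≡n b≤2m+1) (m∸[m∸n]≡n e≤3m) ⟩
    (0 , b , m , e)
      ∎)
  where
  open ≡-Reasoning
  e≤3m : e ≤ m + m + m
  e≤3m = ≤-trans e≤2m (m≤m+n (m + m) m)
  b≤2m+1 : b ≤ suc (m + m)
  b≤2m+1 = m≤n⇒m≤1+n (≤-trans b≤m (m≤m+n m m))
  s k : ℕ
  s = m + m + m ∸ e
  k = suc (m + m) ∸ b
  m≤s×Code-k = D₂⇒Code b+m≤e e≤2m (m∸n+n≡m e≤3m) (m∸n+n≡m b≤2m+1)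
  m≤s = proj₁ m≤s×Code-k
  Code-k = proj₂ m≤s×Code-k

dinv-decode : ∀ {m s k} → Code m (s , k) → dinv m (decode m (s , k)) ≡ + s
dinv-decode {m} {s} {k} c = dinv-from-sum {m} {decode m (s , k)}
  (subst (λ z → dinv m (decode m (s , k)) ℤ.+ + z ≡ + (m + m + m)) (lastEntry-decode {m} {s} {k})
    (dinv-D₁₂ m (decode-D₁₂ c)))
  (m+[n∸m]≡n (Code⇒s≤3m c))

area-decode : ∀ {m s k} → Code m (s , k) → area (decode m (s , k)) + (s + k) ≡ suc (m + m + m + (m + m + m))
area-decode {m} {s} {k} c@(code _ _ k≤2m+1) with s <? m
... | yes s<m =
  area-D₁ (m∸n+n≡m (Code⇒k≤1+s+m s<m c)) (m∸n+n≡m (Code⇒s≤2m c)) (m∸n+n≡m (Code⇒s≤3m c))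
  where
  open ≡-Reasoning
  area-D₁ : ∀ {b x e} → b + k ≡ suc (s + m) → x + s ≡ m + m → e + s ≡ m + m + m →
    b + x + e + (s + k) ≡ suc (m + m + m + (m + m + m))
  area-D₁ {b} {x} {e} b+k≡ x+s≡ e+s≡ = begin
    b + x + e + (s + k)               ≡⟨ solve (b L.∷ x L.∷ e L.∷ s L.∷ k L.∷ L.[]) ⟩
    b + k + (x + s) + e               ≡⟨ cong₂ (λ u v → u + v + e) b+k≡ x+s≡ ⟩
    suc (s + m) + (m + m) + e         ≡⟨ solve (s L.∷ m L.∷ e L.∷ L.[]) ⟩
    suc (m + m + m) + (e + s)         ≡⟨ cong (λ z → suc (m + m + m) + z) e+s≡ ⟩
    suc (m + m + m) + (m + m + m)     ∎
... | no _ = area-D₂ (m∸n+n≡m k≤2m+1) (m∸n+n≡m (Code⇒s≤3m c))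
  where
  open ≡-Reasoning
  area-D₂ : ∀ {b e} → b + k ≡ suc (m + m) → e + s ≡ m + m + m →
    b + m + e + (s + k) ≡ suc (m + m + m + (m + m + m))
  area-D₂ {b} {e} b+k≡ e+s≡ = begin
    b + m + e + (s + k)               ≡⟨ solve (b L.∷ m L.∷ e L.∷ s L.∷ k L.∷ L.[]) ⟩
    b + k + m + (e + s)               ≡⟨ cong₂ (λ u v → u + m + v) b+k≡ e+s≡ ⟩
    suc (m + m) + m + (m + m + m)     ∎

square-swap : ∀ m → AreaDinvSwap m (Square m) (D₁₂ m)
square-swap m = record
  { f            = decode m ∘ encode
  ; f-into       = decode-D₁₂ ∘ encode-Code
  ; f-injective  = λ p q eq → encode-injective p q (decode-injective (encode-Code p) (encode-Code q) eq)
  ; f-surjective = surjective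
  ; dinv-f       = λ { sq@(square _ _) → dinv-decode (encode-Code sq) }
  ; area-f       = area-f
  }
  where
  surjective : ∀ {γ} → D₁₂ m γ → ∃ λ δ → Square m δ × decode m (encode δ) ≡ γ
  surjective D with decode-surjective D
  ... | p , Code-p , refl with encode-surjective Code-p
  ... | δ , Square-δ , refl = δ , Square-δ , refl
  area-f : ∀ {δ} → Square m δ → + area (decode m (encode δ)) ≡ dinv m δ
  area-f sq@(square {c} {d} c≤m d≤m) =
    sym (dinv-from-sum {m} {0 , 0 , c , d} (dinv-square m c≤m d≤m) (area-decode (encode-Code sq)))

lemma4p6 : (m : ℕ) → m ≥ 1 →
    ((a d : ℤ) →
      coeffQT m (sub m (λ γ → inD1 m γ ∨ inD2 m γ)) a d
        ≡ coeffTQ m (sub m (λ γ → inD1' m γ ∨ inD2' m γ)) a d)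
    × ((a d : ℤ) →
      coeffQT m (sub m (inD3 m)) a d ≡ coeffTQ m (sub m (inD3' m)) a d)
lemma4p6 m _ =
  swap⇒coeffQT≡coeffTQ (λ γ → inD1 m γ ∨ inD2 m γ) (λ γ → inD1' m γ ∨ inD2' m γ)
    ∈D₁₂ ∈Square (square-swap m) ,
  swap⇒coeffQT≡coeffTQ (inD3 m) (inD3' m) ∈D₃ ∈D₃′ (reflect-swap m)
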